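{- For a black-white array (as defined in the context) holding up to $n=2^m$ values, the amortized (expected) time of a successful search is $O(\log n)$, provided the values are uniformly distributed, i.e. the searched value lies in a given active segment with probability proportional to the length of that segment.
   Context: Black-white array (BWA): values from a totally ordered set are stored in a white array $W$ and a black array $B$, each divided into segments, the segment of rank $j$ being the index range $[2^j,2^{j+1}-1]$ (length $2^j$). A counter $\mathtt{total}$ records the number of stored values; the segment of rank $i$ is active iff bit $i$ of $\mathtt{total}$ is $1$. In a stable state all stored values lie in the active white segments, each sorted in ascending order. Search$(v)$: for the ranks $i$ from the highest down to $0$, if the segment of rank $i$ is active, perform a binary search (time $O(\log 2^i)$) for $v$ in the white segment of rank $i$; return the index of the first occurrence found, or Nil if not found. A search is a hit (successful) if $v$ is stored in the BWA. -}

module Defs where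

open import Data.Nat using (ℕ; zero; suc; _+_; _*_; _∸_; _^_; _≤_)
open import Data.Nat.DivMod using (_/_; _%_)

-- bit i of total (0 or 1): the segment of rank i is active iff bit total i ≡ 1
bit : ℕ → ℕ → ℕ
bit t zero    = t % 2
bit t (suc i) = bit (t / 2) i

sumFrom : (ℕ → ℕ) → ℕ → ℕ → ℕ
sumFrom f i zero    = 0
sumFrom f i (suc k) = f i + sumFrom f (suc i) k

-- Cost of a successful search whose value is (first) found in the white
-- segment of rank i, when ranks range over 0..m:  binary searches are done
-- in every active segment of rank j, for j from m down to i; the binary
-- search in the segment of rank j costs  cost j  (with cost j = O(log 2^j)).
searchCost : (cost : ℕ → ℕ) (total m i : ℕ) → ℕ
searchCost cost total m i = sumFrom (λ j → bit total j * cost j) i (suc m ∸ i)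

-- total × (expected cost of a successful search), where the value lies in the
-- active segment of rank i with probability 2^i / total (proportional to its
-- length; the active lengths sum to total).
weightedExpectedCost : (cost : ℕ → ℕ) (total m : ℕ) → ℕ
weightedExpectedCost cost total m =
  sumFrom (λ i → bit total i * 2 ^ i * searchCost cost total m i) 0 (suc m)

-- Every binary search costs at most K (m+1), so the weighted cost is at most
-- K (m+1) · Σᵢ bᵢ 2ⁱ · #{ j ≥ i | bⱼ = 1 }.  Peeling off the lowest bit
-- (which halves every remaining weight) shows by induction that this
-- weighted suffix count plus the number of active segments is at most twice
-- Σᵢ bᵢ 2ⁱ, and for the binary digits of total the latter sum is total.
module Submission where

open import Defs
open import Data.Nat using (ℕ; zero; suc; _+_; _*_; _∸_; _^_; _≤_; _<_; z≤n; s≤s)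
open import Data.Nat.Properties
open import Data.Nat.DivMod using (_/_; _%_; m≡m%n+[m/n]*n; m%n<n)
open import Data.Nat.Tactic.RingSolver using (solve-∀)
open import Data.Product using (∃; _,_)
open import Relation.Binary.PropositionalEquality using (_≡_; refl; sym; trans; cong; cong₂; subst; module ≡-Reasoning)

sumFrom-suc : ∀ f i k → sumFrom f (suc i) k ≡ sumFrom (λ j → f (suc j)) i k
sumFrom-suc f i zero    = refl
sumFrom-suc f i (suc k) = cong (f (suc i) +_) (sumFrom-suc f (suc i) k)

sumFrom-cong : ∀ {f g} i k → (∀ j → f j ≡ g j) → sumFrom f i k ≡ sumFrom g i k
sumFrom-cong i zero    f≡g = refl
sumFrom-cong i (suc k) f≡g = cong₂ _+_ (f≡g i) (sumFrom-cong (suc i) k f≡g)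

sumFrom-*ˡ : ∀ c f i k → sumFrom (λ j → c * f j) i k ≡ c * sumFrom f i k
sumFrom-*ˡ c f i zero    = sym (*-zeroʳ c)
sumFrom-*ˡ c f i (suc k) =
  trans (cong (c * f i +_) (sumFrom-*ˡ c f (suc i) k)) (sym (*-distribˡ-+ c (f i) _))

sumFrom-mono-≤ : ∀ {f g} i k → (∀ j → j < i + k → f j ≤ g j) → sumFrom f i k ≤ sumFrom g i k
sumFrom-mono-≤ i zero    f≤g = z≤n
sumFrom-mono-≤ i (suc k) f≤g =
  +-mono-≤ (f≤g i (subst (i <_) (sym (+-suc i k)) (s≤s (m≤m+n i k))))
           (sumFrom-mono-≤ (suc i) k (λ j j< → f≤g j (subst (j <_) (sym (+-suc i k)) j<)))

bit≤1 : ∀ t i → bit t i ≤ 1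
bit≤1 t zero    = ≤-pred (m%n<n t 2)
bit≤1 t (suc i) = bit≤1 (t / 2) i

binaryValue : (ℕ → ℕ) → ℕ → ℕ
binaryValue b N = sumFrom (λ i → b i * 2 ^ i) 0 N

weightedSuffixCount : (ℕ → ℕ) → ℕ → ℕ
weightedSuffixCount b N = sumFrom (λ i → b i * 2 ^ i * sumFrom b i (N ∸ i)) 0 N

tail : (ℕ → ℕ) → ℕ → ℕ
tail b j = b (suc j)

binaryValue-suc : ∀ b N → binaryValue b (suc N) ≡ b 0 * 1 + 2 * binaryValue (tail b) N
binaryValue-suc b N = cong (b 0 * 1 +_) (begin
    sumFrom (λ i → b i * 2 ^ i) 1 N
  ≡⟨ sumFrom-suc (λ i → b i * 2 ^ i) 0 N ⟩
    sumFrom (λ i → b (suc i) * (2 * 2 ^ i)) 0 N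
  ≡⟨ sumFrom-cong 0 N (λ i → double (b (suc i)) (2 ^ i)) ⟩
    sumFrom (λ i → 2 * (b (suc i) * 2 ^ i)) 0 N
  ≡⟨ sumFrom-*ˡ 2 (λ i → b (suc i) * 2 ^ i) 0 N ⟩
    2 * binaryValue (tail b) N ∎)
  where
  open ≡-Reasoning
  double : ∀ x y → x * (2 * y) ≡ 2 * (x * y)
  double = solve-∀

weightedSuffixCount-suc : ∀ b N →
  weightedSuffixCount b (suc N) ≡ b 0 * 1 * sumFrom b 0 (suc N) + 2 * weightedSuffixCount (tail b) N
weightedSuffixCount-suc b N = cong (b 0 * 1 * sumFrom b 0 (suc N) +_) (begin
    sumFrom (λ i → b i * 2 ^ i * sumFrom b i (suc N ∸ i)) 1 N
  ≡⟨ sumFrom-suc (λ i → b i * 2 ^ i * sumFrom b i (suc N ∸ i)) 0 N ⟩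
    sumFrom (λ i → b (suc i) * (2 * 2 ^ i) * sumFrom b (suc i) (N ∸ i)) 0 N
  ≡⟨ sumFrom-cong 0 N term ⟩
    sumFrom (λ i → 2 * (b (suc i) * 2 ^ i * sumFrom (tail b) i (N ∸ i))) 0 N
  ≡⟨ sumFrom-*ˡ 2 (λ i → b (suc i) * 2 ^ i * sumFrom (tail b) i (N ∸ i)) 0 N ⟩
    2 * weightedSuffixCount (tail b) N ∎)
  where
  open ≡-Reasoning
  double : ∀ x y z → x * (2 * y) * z ≡ 2 * (x * y * z)
  double = solve-∀
  term : ∀ i → b (suc i) * (2 * 2 ^ i) * sumFrom b (suc i) (N ∸ i)
             ≡ 2 * (b (suc i) * 2 ^ i * sumFrom (tail b) i (N ∸ i))
  term i = trans (cong (b (suc i) * (2 * 2 ^ i) *_) (sumFrom-suc b i (N ∸ i)))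
                 (double (b (suc i)) (2 ^ i) (sumFrom (tail b) i (N ∸ i)))

weightedSuffixCount+count≤2*binaryValue : ∀ b → (∀ i → b i ≤ 1) → ∀ N →
  weightedSuffixCount b N + sumFrom b 0 N ≤ 2 * binaryValue b N
weightedSuffixCount+count≤2*binaryValue b b≤1 zero    = z≤n
weightedSuffixCount+count≤2*binaryValue b b≤1 (suc N) = begin
    weightedSuffixCount b (suc N) + sumFrom b 0 (suc N)
  ≡⟨ cong₂ _+_ (trans (weightedSuffixCount-suc b N) (cong (λ z → x * 1 * z + 2 * s) count-suc))
               count-suc ⟩
    x * 1 * (x + c) + 2 * s + (x + c)
  ≤⟨ +-monoˡ-≤ (x + c) (+-monoˡ-≤ (2 * s) (*-monoˡ-≤ (x + c) x≤1)) ⟩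
    1 * (x + c) + 2 * s + (x + c)
  ≡⟨ regroup x c s ⟩
    2 * x + 2 * (s + c)
  ≤⟨ +-monoʳ-≤ (2 * x) (*-monoʳ-≤ 2 (weightedSuffixCount+count≤2*binaryValue (tail b) (λ i → b≤1 (suc i)) N)) ⟩
    2 * x + 2 * (2 * binaryValue (tail b) N)
  ≡⟨ factor x (binaryValue (tail b) N) ⟩
    2 * (x * 1 + 2 * binaryValue (tail b) N)
  ≡⟨ cong (2 *_) (sym (binaryValue-suc b N)) ⟩
    2 * binaryValue b (suc N) ∎
  where
  open ≤-Reasoning
  x = b 0
  c = sumFrom (tail b) 0 N
  s = weightedSuffixCount (tail b) N
  count-suc : sumFrom b 0 (suc N) ≡ x + c
  count-suc = cong (x +_) (sumFrom-suc b 0 N)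
  x≤1 : x * 1 ≤ 1
  x≤1 = ≤-trans (≤-reflexive (*-identityʳ x)) (b≤1 0)
  regroup : ∀ x c s → 1 * (x + c) + 2 * s + (x + c) ≡ 2 * x + 2 * (s + c)
  regroup = solve-∀
  factor : ∀ x p → 2 * x + 2 * (2 * p) ≡ 2 * (x * 1 + 2 * p)
  factor = solve-∀

-- Only the lowest N binary digits enter, so this holds for every t.
binaryValue-bit≤ : ∀ N t → binaryValue (bit t) N ≤ t
binaryValue-bit≤ zero    t = z≤n
binaryValue-bit≤ (suc N) t = begin
    binaryValue (bit t) (suc N)
  ≡⟨ binaryValue-suc (bit t) N ⟩
    t % 2 * 1 + 2 * binaryValue (bit (t / 2)) N
  ≤⟨ +-monoʳ-≤ (t % 2 * 1) (*-monoʳ-≤ 2 (binaryValue-bit≤ N (t / 2))) ⟩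
    t % 2 * 1 + 2 * (t / 2)
  ≡⟨ reorder (t % 2) (t / 2) ⟩
    t % 2 + t / 2 * 2
  ≡⟨ sym (m≡m%n+[m/n]*n t 2) ⟩
    t ∎
  where
  open ≤-Reasoning
  reorder : ∀ x y → x * 1 + 2 * y ≡ x + y * 2
  reorder = solve-∀

searchCost≤ : ∀ {cost} d t m i → (∀ j → j ≤ m → cost j ≤ d) → i ≤ m →
  searchCost cost t m i ≤ d * sumFrom (bit t) i (suc m ∸ i)
searchCost≤ {cost} d t m i cost≤d i≤m = begin
    searchCost cost t m i
  ≤⟨ sumFrom-mono-≤ i (suc m ∸ i) term≤ ⟩
    sumFrom (λ j → d * bit t j) i (suc m ∸ i)
  ≡⟨ sumFrom-*ˡ d (bit t) i (suc m ∸ i) ⟩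
    d * sumFrom (bit t) i (suc m ∸ i) ∎
  where
  open ≤-Reasoning
  term≤ : ∀ j → j < i + (suc m ∸ i) → bit t j * cost j ≤ d * bit t j
  term≤ j j< = ≤-trans (*-monoʳ-≤ (bit t j) (cost≤d j (≤-pred (subst (j <_) (m+[n∸m]≡n (m≤n⇒m≤1+n i≤m)) j<))))
                       (≤-reflexive (*-comm (bit t j) d))

weightedExpectedCost≤ : ∀ {cost} d t m → (∀ j → j ≤ m → cost j ≤ d) →
  weightedExpectedCost cost t m ≤ d * weightedSuffixCount (bit t) (suc m)
weightedExpectedCost≤ {cost} d t m cost≤d = begin
    weightedExpectedCost cost t m
  ≤⟨ sumFrom-mono-≤ 0 (suc m) term≤ ⟩
    sumFrom (λ i → d * (weight i * count i)) 0 (suc m)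
  ≡⟨ sumFrom-*ˡ d (λ i → weight i * count i) 0 (suc m) ⟩
    d * weightedSuffixCount (bit t) (suc m) ∎
  where
  open ≤-Reasoning
  weight = λ i → bit t i * 2 ^ i
  count = λ i → sumFrom (bit t) i (suc m ∸ i)
  swap : ∀ x y z → x * (y * z) ≡ y * (x * z)
  swap = solve-∀
  term≤ : ∀ i → i < suc m → weight i * searchCost cost t m i ≤ d * (weight i * count i)
  term≤ i i<1+m = ≤-trans (*-monoʳ-≤ (weight i) (searchCost≤ d t m i cost≤d (≤-pred i<1+m)))
                          (≤-reflexive (swap (weight i) d (count i)))

-- The constant C = 2K works for every total.
mainTheorem9 : (K : ℕ) → ∃ λ C → (cost : ℕ → ℕ) → (∀ j → cost j ≤ K * suc j) →
    (m total : ℕ) → 1 ≤ total → total ≤ 2 ^ m →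
    weightedExpectedCost cost total m ≤ C * suc m * total
mainTheorem9 K = 2 * K , λ cost cost≤ m t _ _ → begin
    weightedExpectedCost cost t m
  ≤⟨ weightedExpectedCost≤ (K * suc m) t m (λ j j≤m → ≤-trans (cost≤ j) (*-monoʳ-≤ K (s≤s j≤m))) ⟩
    K * suc m * weightedSuffixCount (bit t) (suc m)
  ≤⟨ *-monoʳ-≤ (K * suc m) (≤-trans (m≤m+n _ _)
       (weightedSuffixCount+count≤2*binaryValue (bit t) (bit≤1 t) (suc m))) ⟩
    K * suc m * (2 * binaryValue (bit t) (suc m))
  ≤⟨ *-monoʳ-≤ (K * suc m) (*-monoʳ-≤ 2 (binaryValue-bit≤ (suc m) t)) ⟩
    K * suc m * (2 * t)
  ≡⟨ regroup K (suc m) t ⟩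
    2 * K * suc m * t ∎
  where
  open ≤-Reasoning
  regroup : ∀ k n t → k * n * (2 * t) ≡ 2 * k * n * t
  regroup = solve-∀
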